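{- Let $C$ be a positive real number and let $H$ be a commutative graph of level two with layers $U_0,U_1,U_2$. Suppose that for every $S\subseteq U_1$, $$|\operatorname{im}(S)|\ge C|S|\quad\text{and}\quad|\operatorname{im}^{ -1}(S)|\ge C^{ -1}|S|.$$ For an integer $i\ge1$ let $X_i$ (resp. $Y_i$) be the set of vertices of $U_1$ (resp. $U_2$) with in-degree exactly $i$, and let $X'_i$ (resp. $Y'_i$) be the set of vertices of $U_1$ (resp. $U_0$) with out-degree exactly $i$. Then for every integer $i\ge 1$, $$C|X_i|=|Y_i|\quad\text{and}\quad C^{ -1}|X'_i|=|Y'_i|.$$
   Context: A directed layered graph of level two has vertex set $U_0\cup U_1\cup U_2$, a disjoint union of finite sets, with every directed edge going from $U_0$ to $U_1$ or from $U_1$ to $U_2$. For a vertex $x$, $\operatorname{im}(x)$, $\operatorname{im}^{ -1}(x)$ denote its out- and in-neighbourhoods, and for a set $S$, $\operatorname{im}(S)=\bigcup_{x\in S}\operatorname{im}(x)$, $\operatorname{im}^{ -1}(S)=\bigcup_{x\in S}\operatorname{im}^{ -1}(x)$. The graph is commutative if: (upward) for every edge $uv$ there is an injective $\varphi:\operatorname{im}(v)\to\operatorname{im}(u)$ with $\varphi(x)x$ an edge for all $x$; and (downward) for every edge $vw$ there is an injective $\psi:\operatorname{im}^{ -1}(v)\to\operatorname{im}^{ -1}(w)$ with $x\psi(x)$ an edge for all $x$. Degrees are taken in $H$. -}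

module Defs where

open import Data.Nat using (ℕ; zero; suc; _+_)
open import Data.Bool using (Bool; true; false; if_then_else_)
open import Data.Fin using (Fin; zero; suc)
open import Data.Integer using (+_)
open import Data.Rational using (ℚ; _/_; _*_; _<_; _≤_; 0ℚ)
open import Data.Product using (Σ; _×_; ∃)
open import Data.Sum using (_⊎_)
open import Data.Empty using (⊥)
open import Relation.Binary.PropositionalEquality using (_≡_)

record ℝ⁺ : Set₁ where
  field
    lower    : ℚ → Set
    upper    : ℚ → Set
    lower-inhabited : ∃ lower
    upper-inhabited : ∃ upper
    lower-closed : ∀ {p q} → p < q → lower q → lower p
    upper-closed : ∀ {p q} → p < q → upper p → upper q
    lower-open   : ∀ {q} → lower q → Σ ℚ λ r → q < r × lower r
    upper-open   : ∀ {q} → upper q → Σ ℚ λ r → r < q × upper r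
    disjoint     : ∀ {q} → lower q → upper q → ⊥
    located      : ∀ {p q} → p < q → lower p ⊎ upper q
    positive     : lower 0ℚ

open ℝ⁺ public

ℕ→ℚ : ℕ → ℚ
ℕ→ℚ n = (+ n) / 1

-- Comparisons of C·a and C⁻¹·a with a natural number b (a, b ∈ ℕ).
-- C·a ≤ b  iff every q < C has q·a ≤ b.
_·_≤ℕ_ : ℝ⁺ → ℕ → ℕ → Set
C · a ≤ℕ b = ∀ q → lower C q → q * ℕ→ℚ a ≤ ℕ→ℚ b

-- b ≤ C·a  iff every q > C has b ≤ q·a.
_≤ℕ_·_ : ℕ → ℝ⁺ → ℕ → Set
b ≤ℕ C · a = ∀ q → upper C q → ℕ→ℚ b ≤ q * ℕ→ℚ a

_·_≡ℕ_ : ℝ⁺ → ℕ → ℕ → Set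
C · a ≡ℕ b = (C · a ≤ℕ b) × (b ≤ℕ C · a)

_⁻¹·_≤ℕ_ : ℝ⁺ → ℕ → ℕ → Set
C ⁻¹· a ≤ℕ b = a ≤ℕ C · b

_⁻¹·_≡ℕ_ : ℝ⁺ → ℕ → ℕ → Set
C ⁻¹· a ≡ℕ b = C · b ≡ℕ a

card : ∀ {n} → (Fin n → Bool) → ℕ
card {zero}  f = 0
card {suc n} f = (if f zero then 1 else 0) + card {n} (λ i → f (suc i))

record Graph2 : Set where
  field
    n₀ n₁ n₂ : ℕ
    E₀₁ : Fin n₀ → Fin n₁ → Bool
    E₁₂ : Fin n₁ → Fin n₂ → Bool

module _ (H : Graph2) where
  open Graph2 H

  im : (Fin n₁ → Bool) → (Fin n₂ → Bool)
  im S w = anyFin (λ v → if S v then E₁₂ v w else false)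
    where
    anyFin : ∀ {m} → (Fin m → Bool) → Bool
    anyFin {zero} f = false
    anyFin {suc m} f = if f zero then true else anyFin (λ i → f (suc i))

  im⁻¹ : (Fin n₁ → Bool) → (Fin n₀ → Bool)
  im⁻¹ S u = anyFin (λ v → if S v then E₀₁ u v else false)
    where
    anyFin : ∀ {m} → (Fin m → Bool) → Bool
    anyFin {zero} f = false
    anyFin {suc m} f = if f zero then true else anyFin (λ i → f (suc i))

  indeg₁ : Fin n₁ → ℕ
  indeg₁ v = card (λ u → E₀₁ u v)

  outdeg₁ : Fin n₁ → ℕ
  outdeg₁ v = card (λ w → E₁₂ v w)

  indeg₂ : Fin n₂ → ℕ
  indeg₂ w = card (λ v → E₁₂ v w)

  outdeg₀ : Fin n₀ → ℕ
  outdeg₀ u = card (λ v → E₀₁ u v)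

  Upward : Set
  Upward = ∀ (u : Fin n₀) (v : Fin n₁) → E₀₁ u v ≡ true →
    Σ ((w : Fin n₂) → E₁₂ v w ≡ true → Fin n₁) λ φ →
      (∀ w (p : E₁₂ v w ≡ true) → E₀₁ u (φ w p) ≡ true × E₁₂ (φ w p) w ≡ true) ×
      (∀ w w′ (p : E₁₂ v w ≡ true) (p′ : E₁₂ v w′ ≡ true) → φ w p ≡ φ w′ p′ → w ≡ w′)

  Downward : Set
  Downward = ∀ (v : Fin n₁) (w : Fin n₂) → E₁₂ v w ≡ true →
    Σ ((x : Fin n₀) → E₀₁ x v ≡ true → Fin n₁) λ ψ →
      (∀ x (p : E₀₁ x v ≡ true) → E₀₁ x (ψ x p) ≡ true × E₁₂ (ψ x p) w ≡ true) ×
      (∀ x x′ (p : E₀₁ x v ≡ true) (p′ : E₀₁ x′ v ≡ true) → ψ x p ≡ ψ x′ p′ → x ≡ x′)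

  Commutative : Set
  Commutative = Upward × Downward

  X : ℕ → Fin n₁ → Bool
  X i v = indeg₁ v Data.Nat.≡ᵇ i

  Y : ℕ → Fin n₂ → Bool
  Y i w = indeg₂ w Data.Nat.≡ᵇ i

  X′ : ℕ → Fin n₁ → Bool
  X′ i v = outdeg₁ v Data.Nat.≡ᵇ i

  Y′ : ℕ → Fin n₀ → Bool
  Y′ i u = outdeg₀ u Data.Nat.≡ᵇ i

-- For k ≥ 1 let a k and b k count the vertices of U₁ and U₂ of in-degree at least k, and c k
-- and d k those of U₁ and U₀ of out-degree at least k. Downward commutativity makes the
-- in-degree weakly increase along an edge U₁ → U₂, so im {in-degree ≥ k} ⊆ {in-degree ≥ k}
-- and expansion gives C·a k ≤ b k; dually, upward commutativity gives c k ≤ C·d k. Summing over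
-- k, both Σ a and Σ d count the edges U₀ → U₁ and both Σ b and Σ c count the edges U₁ → U₂, so
--   C·Σ a ≤ Σ b = Σ c ≤ C·Σ d = C·Σ a,
-- and all these inequalities, hence also the termwise ones, are equalities. The claim follows
-- from |X i| = a i − a (i+1) and its three analogues. As C is only given as a Dedekind cut, the
-- comparisons are made with the rational e₁₂/e₀₁ (a ratio of edge counts), which the summed
-- inequalities force C to equal as soon as there are edges at all.

module Submission where

open import Defs
import Data.Nat as ℕ
import Data.Nat.Properties as ℕ
open import Algebra.Properties.Semiring.Sum ℕ.+-*-semiring
  using (sum; sum-syntax; sum-cong-≗; ∑-comm; ∑-distrib-+; sum-replicate-zero;
         *-distribˡ-sum; *-distribʳ-sum)
open import Data.Bool using (Bool; true; false; if_then_else_; _∧_; not; T)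
open import Data.Bool.Properties using (∧-identityʳ; ∧-zeroʳ; T-≡)
open import Data.Empty using (⊥-elim)
open import Data.Fin using (Fin; zero; suc; toℕ; fromℕ<)
open import Data.Fin.Properties using (_≟_; suc-injective; toℕ-fromℕ<)
open import Data.Product using (Σ; _×_; _,_; proj₁; proj₂)
open import Data.Sum using (inj₁; inj₂)
open import Function using (_∘_; id; Equivalence)
open import Relation.Nullary using (does; yes; no; contradiction)
open import Relation.Binary.PropositionalEquality

-- Positive reals compared with ratios of natural numbers

module _ where
  open import Data.Nat using (ℕ; zero; suc; z≤n)
  import Data.Nat.Coprimality as Coprime
  open import Data.Integer as ℤ using (+_)
  import Data.Integer.Properties as ℤ
  open import Data.Rational
    using (ℚ; mkℚ; 1ℚ; _+_; _*_; _÷_; 1/_; _≤_; _<_; *≤*;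
           NonNegative; Positive; NonZero; nonNegative)
  open import Data.Rational.Properties
  open import Algebra.Bundles using (CommutativeRing)
  open import Algebra.Properties.CommutativeSemigroup
    (CommutativeRing.*-commutativeSemigroup +-*-commutativeRing) using (xy∙z≈xz∙y)
  open import Relation.Binary.Definitions using (tri<; tri≈; tri>)

  ℕ→ℚ≡mkℚ : ∀ n → ℕ→ℚ n ≡ mkℚ (+ n) 0 (Coprime.sym (Coprime.1-coprimeTo n))
  ℕ→ℚ≡mkℚ n = ↥p/↧p≡p _

  ℕ→ℚ-+ : ∀ m n → ℕ→ℚ (m ℕ.+ n) ≡ ℕ→ℚ m + ℕ→ℚ n
  ℕ→ℚ-+ m n rewrite ℕ→ℚ≡mkℚ m | ℕ→ℚ≡mkℚ n =
    /-cong (cong₂ ℤ._+_ (sym (ℤ.*-identityʳ (+ m))) (sym (ℤ.*-identityʳ (+ n)))) refl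

  ℕ→ℚ-* : ∀ m n → ℕ→ℚ (m ℕ.* n) ≡ ℕ→ℚ m * ℕ→ℚ n
  ℕ→ℚ-* m n rewrite ℕ→ℚ≡mkℚ m | ℕ→ℚ≡mkℚ n = /-cong (ℤ.pos-* m n) refl

  ℕ→ℚ-mono-≤ : ∀ {m n} → m ℕ.≤ n → ℕ→ℚ m ≤ ℕ→ℚ n
  ℕ→ℚ-mono-≤ {m} {n} m≤n rewrite ℕ→ℚ≡mkℚ m | ℕ→ℚ≡mkℚ n =
    *≤* (subst₂ ℤ._≤_ (sym (ℤ.*-identityʳ _)) (sym (ℤ.*-identityʳ _)) (ℤ.+≤+ m≤n))

  ℕ→ℚ-cancel-≤ : ∀ {m n} → ℕ→ℚ m ≤ ℕ→ℚ n → m ℕ.≤ n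
  ℕ→ℚ-cancel-≤ {m} {n} le rewrite ℕ→ℚ≡mkℚ m | ℕ→ℚ≡mkℚ n with *≤* le′ ← le =
    ℤ.drop‿+≤+ (subst₂ ℤ._≤_ (ℤ.*-identityʳ _) (ℤ.*-identityʳ _) le′)

  ℕ→ℚ-nonNeg : ∀ n → NonNegative (ℕ→ℚ n)
  ℕ→ℚ-nonNeg n = normalize-nonNeg n 1

  ℕ→ℚ-pos : ∀ n .{{_ : ℕ.NonZero n}} → Positive (ℕ→ℚ n)
  ℕ→ℚ-pos n = normalize-pos n 1

  _/ℕ_ : ℕ → (a : ℕ) → .{{ℕ.NonZero a}} → ℚ
  (b /ℕ a) = _÷_ (ℕ→ℚ b) (ℕ→ℚ a) {{pos⇒nonZero (ℕ→ℚ a) {{ℕ→ℚ-pos a}}}}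

  module _ {a : ℕ} .{{_ : ℕ.NonZero a}} where
    private instance
      a-pos : Positive (ℕ→ℚ a)
      a-pos = ℕ→ℚ-pos a
      a-nonZero : NonZero (ℕ→ℚ a)
      a-nonZero = pos⇒nonZero (ℕ→ℚ a)

    /ℕ-*-cancel : ∀ b → (b /ℕ a) * ℕ→ℚ a ≡ ℕ→ℚ b
    /ℕ-*-cancel b = begin
      ℕ→ℚ b * 1/ ℕ→ℚ a * ℕ→ℚ a    ≡⟨ *-assoc (ℕ→ℚ b) _ _ ⟩
      ℕ→ℚ b * (1/ ℕ→ℚ a * ℕ→ℚ a)  ≡⟨ cong (ℕ→ℚ b *_) (*-inverseˡ (ℕ→ℚ a)) ⟩
      ℕ→ℚ b * 1ℚ                   ≡⟨ *-identityʳ (ℕ→ℚ b) ⟩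
      ℕ→ℚ b                        ∎
      where open ≡-Reasoning

    *≤⇒≤/ℕ : ∀ {p b} → p * ℕ→ℚ a ≤ ℕ→ℚ b → p ≤ b /ℕ a
    *≤⇒≤/ℕ {p} {b} pa≤b = *-cancelʳ-≤-pos (ℕ→ℚ a) (subst (p * ℕ→ℚ a ≤_) (sym (/ℕ-*-cancel b)) pa≤b)

    ≤*⇒/ℕ≤ : ∀ {q b} → ℕ→ℚ b ≤ q * ℕ→ℚ a → b /ℕ a ≤ q
    ≤*⇒/ℕ≤ {q} {b} b≤qa = *-cancelʳ-≤-pos (ℕ→ℚ a) (subst (_≤ q * ℕ→ℚ a) (sym (/ℕ-*-cancel b)) b≤qa)

  /ℕ-cross : ∀ {a b c d} .{{_ : ℕ.NonZero a}} .{{_ : ℕ.NonZero c}} →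
             b /ℕ a ≤ d /ℕ c → b ℕ.* c ℕ.≤ d ℕ.* a
  /ℕ-cross {a} {b} {c} {d} b/a≤d/c = ℕ→ℚ-cancel-≤ (begin
    ℕ→ℚ (b ℕ.* c)            ≡⟨ ℕ→ℚ-* b c ⟩
    ℕ→ℚ b * ℕ→ℚ c            ≡⟨ cong (_* ℕ→ℚ c) (/ℕ-*-cancel b) ⟨
    b /ℕ a * ℕ→ℚ a * ℕ→ℚ c   ≡⟨ xy∙z≈xz∙y (b /ℕ a) _ _ ⟩
    b /ℕ a * ℕ→ℚ c * ℕ→ℚ a   ≤⟨ *-monoʳ-≤-nonNeg (ℕ→ℚ a) {{ℕ→ℚ-nonNeg a}}
                                  (*-monoʳ-≤-nonNeg (ℕ→ℚ c) {{ℕ→ℚ-nonNeg c}} b/a≤d/c) ⟩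
    d /ℕ c * ℕ→ℚ c * ℕ→ℚ a   ≡⟨ cong (_* ℕ→ℚ a) (/ℕ-*-cancel d) ⟩
    ℕ→ℚ d * ℕ→ℚ a            ≡⟨ ℕ→ℚ-* d a ⟨
    ℕ→ℚ (d ℕ.* a)            ∎)
    where open ≤-Reasoning

  module _ (C : ℝ⁺) where

    lower<upper : ∀ {p q} → lower C p → upper C q → p < q
    lower<upper {p} {q} lp uq with <-cmp p q
    ... | tri< p<q _ _ = p<q
    ... | tri≈ _ refl _ = ⊥-elim (disjoint C lp uq)
    ... | tri> _ _ q<p = ⊥-elim (disjoint C (lower-closed C q<p lp) uq)

    upper-nonNeg : ∀ {q} → upper C q → NonNegative q
    upper-nonNeg uq = nonNegative (<⇒≤ (lower<upper (positive C) uq))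

    no-gap : ∀ {x y} → (∀ p → lower C p → p ≤ x) → (∀ q → upper C q → y ≤ q) → y ≤ x
    no-gap {x} {y} lower≤x y≤upper with y ≤? x
    ... | yes y≤x = y≤x
    ... | no y≰x with <-dense (≰⇒> y≰x)
    ... | p , x<p , p<y with <-dense p<y
    ... | q , p<q , q<y with located C p<q
    ... | inj₁ lp = ⊥-elim (<-irrefl refl (<-≤-trans x<p (lower≤x p lp)))
    ... | inj₂ uq = ⊥-elim (<-irrefl refl (<-≤-trans q<y (y≤upper q uq)))

    ·≤ℕ-monoʳ : ∀ {a b b′} → C · a ≤ℕ b → b ℕ.≤ b′ → C · a ≤ℕ b′
    ·≤ℕ-monoʳ h b≤b′ p lp = ≤-trans (h p lp) (ℕ→ℚ-mono-≤ b≤b′)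

    ≤ℕ·-monoʳ : ∀ {c d d′} → c ≤ℕ C · d → d ℕ.≤ d′ → c ≤ℕ C · d′
    ≤ℕ·-monoʳ h d≤d′ q uq =
      ≤-trans (h q uq) (*-monoˡ-≤-nonNeg q {{upper-nonNeg uq}} (ℕ→ℚ-mono-≤ d≤d′))

    ·≤ℕ-+ : ∀ {a a′ b b′} → C · a ≤ℕ b → C · a′ ≤ℕ b′ → C · (a ℕ.+ a′) ≤ℕ (b ℕ.+ b′)
    ·≤ℕ-+ {a} {a′} {b} {b′} h h′ p lp = begin
      p * ℕ→ℚ (a ℕ.+ a′)      ≡⟨ cong (p *_) (ℕ→ℚ-+ a a′) ⟩
      p * (ℕ→ℚ a + ℕ→ℚ a′)    ≡⟨ *-distribˡ-+ p _ _ ⟩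
      p * ℕ→ℚ a + p * ℕ→ℚ a′  ≤⟨ +-mono-≤ (h p lp) (h′ p lp) ⟩
      ℕ→ℚ b + ℕ→ℚ b′          ≡⟨ ℕ→ℚ-+ b b′ ⟨
      ℕ→ℚ (b ℕ.+ b′)          ∎
      where open ≤-Reasoning

    ≤ℕ·-+ : ∀ {a a′ b b′} → b ≤ℕ C · a → b′ ≤ℕ C · a′ → (b ℕ.+ b′) ≤ℕ C · (a ℕ.+ a′)
    ≤ℕ·-+ {a} {a′} {b} {b′} h h′ q uq = begin
      ℕ→ℚ (b ℕ.+ b′)          ≡⟨ ℕ→ℚ-+ b b′ ⟩
      ℕ→ℚ b + ℕ→ℚ b′          ≤⟨ +-mono-≤ (h q uq) (h′ q uq) ⟩
      q * ℕ→ℚ a + q * ℕ→ℚ a′  ≡⟨ *-distribˡ-+ q _ _ ⟨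
      q * (ℕ→ℚ a + ℕ→ℚ a′)    ≡⟨ cong (q *_) (ℕ→ℚ-+ a a′) ⟨
      q * ℕ→ℚ (a ℕ.+ a′)      ∎
      where open ≤-Reasoning

    ·≤ℕ-∑ : ∀ {n} {f g : Fin n → ℕ} → (∀ i → C · f i ≤ℕ g i) → C · sum f ≤ℕ sum g
    ·≤ℕ-∑ {zero}  h p _ = ≤-reflexive (*-zeroʳ p)
    ·≤ℕ-∑ {suc n} {f} {g} h = ·≤ℕ-+ {f zero} {sum (f ∘ suc)} {g zero} (h zero) (·≤ℕ-∑ (h ∘ suc))

    ≤ℕ·-∑ : ∀ {n} {f g : Fin n → ℕ} → (∀ i → g i ≤ℕ C · f i) → sum g ≤ℕ C · sum f
    ≤ℕ·-∑ {zero}  h q _ = ≤-reflexive (sym (*-zeroʳ q))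
    ≤ℕ·-∑ {suc n} {f} {g} h = ≤ℕ·-+ {f zero} {sum (f ∘ suc)} {g zero} (h zero) (≤ℕ·-∑ (h ∘ suc))

    ·≡ℕ-zero : C · 0 ≡ℕ 0
    ·≡ℕ-zero = (λ p _ → ≤-reflexive (*-zeroʳ p)) , (λ q _ → ≤-reflexive (sym (*-zeroʳ q)))

    ≤ℕ·-zero : ∀ {b} → b ≤ℕ C · 0 → b ≡ 0
    ≤ℕ·-zero h with q , uq ← upper-inhabited C =
      ℕ.n≤0⇒n≡0 (ℕ→ℚ-cancel-≤ (≤-trans (h q uq) (≤-reflexive (*-zeroʳ q))))

  -- With A ≠ 0, C · A ≡ℕ B pins C down to the rational B / A, so comparisons with C become
  -- cross-multiplied comparisons of natural numbers.
  module _ (C : ℝ⁺) (A B : ℕ) .{{_ : ℕ.NonZero A}} (C·A≡B : C · A ≡ℕ B) where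

    ·≤ℕ⇒cross : ∀ a b → C · a ≤ℕ b → B ℕ.* a ℕ.≤ b ℕ.* A
    ·≤ℕ⇒cross zero b _ = subst (ℕ._≤ b ℕ.* A) (sym (ℕ.*-zeroʳ B)) z≤n
    ·≤ℕ⇒cross a@(suc _) b h = /ℕ-cross {A} {B} {a} {b} (no-gap C
      (λ p lp → *≤⇒≤/ℕ {a} {b = b} (h p lp)) (λ q uq → ≤*⇒/ℕ≤ {A} {b = B} (proj₂ C·A≡B q uq)))

    ≤ℕ·⇒cross : ∀ c d → c ≤ℕ C · d → c ℕ.* A ℕ.≤ B ℕ.* d
    ≤ℕ·⇒cross c zero h with refl ← ≤ℕ·-zero C {c} h = z≤n
    ≤ℕ·⇒cross c d@(suc _) h = /ℕ-cross {d} {c} {A} {B} (no-gap C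
      (λ p lp → *≤⇒≤/ℕ {A} {b = B} (proj₁ C·A≡B p lp)) (λ q uq → ≤*⇒/ℕ≤ {d} {b = c} (h q uq)))

    cross⇒·≡ℕ : ∀ x y → B ℕ.* x ≡ y ℕ.* A → C · x ≡ℕ y
    cross⇒·≡ℕ x y Bx≡yA = lower-bound , upper-bound
      where
      open ≤-Reasoning
      instance
        A-pos : Positive (ℕ→ℚ A)
        A-pos = ℕ→ℚ-pos A
        x-nonNeg : NonNegative (ℕ→ℚ x)
        x-nonNeg = ℕ→ℚ-nonNeg x
      Bx≡yAℚ : ℕ→ℚ B * ℕ→ℚ x ≡ ℕ→ℚ y * ℕ→ℚ A
      Bx≡yAℚ = trans (sym (ℕ→ℚ-* B x)) (trans (cong ℕ→ℚ Bx≡yA) (ℕ→ℚ-* y A))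
      lower-bound : C · x ≤ℕ y
      lower-bound p lp = *-cancelʳ-≤-pos (ℕ→ℚ A) (begin
        p * ℕ→ℚ x * ℕ→ℚ A  ≡⟨ xy∙z≈xz∙y p _ _ ⟩
        p * ℕ→ℚ A * ℕ→ℚ x  ≤⟨ *-monoʳ-≤-nonNeg (ℕ→ℚ x) (proj₁ C·A≡B p lp) ⟩
        ℕ→ℚ B * ℕ→ℚ x      ≡⟨ Bx≡yAℚ ⟩
        ℕ→ℚ y * ℕ→ℚ A      ∎)
      upper-bound : y ≤ℕ C · x
      upper-bound q uq = *-cancelʳ-≤-pos (ℕ→ℚ A) (begin
        ℕ→ℚ y * ℕ→ℚ A      ≡⟨ Bx≡yAℚ ⟨
        ℕ→ℚ B * ℕ→ℚ x      ≤⟨ *-monoʳ-≤-nonNeg (ℕ→ℚ x) (proj₂ C·A≡B q uq) ⟩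
        q * ℕ→ℚ A * ℕ→ℚ x  ≡⟨ xy∙z≈xz∙y q _ _ ⟩
        q * ℕ→ℚ x * ℕ→ℚ A  ∎)

open import Data.Nat using (ℕ; zero; suc; z≤n; s≤s; _≤_; _≥_; _+_; _*_; _≤ᵇ_; _≡ᵇ_; _⊓_)

-- Counting subsets of Fin n

𝟙 : Bool → ℕ
𝟙 b = if b then 1 else 0

card≡∑ : ∀ {n} (P : Fin n → Bool) → card P ≡ sum (𝟙 ∘ P)
card≡∑ {zero}  P = refl
card≡∑ {suc n} P = cong (𝟙 (P zero) +_) (card≡∑ (P ∘ suc))

card-cong : ∀ {n} {P Q : Fin n → Bool} → (∀ x → P x ≡ Q x) → card P ≡ card Q
card-cong {zero}  eq = refl
card-cong {suc n} eq = cong₂ _+_ (cong 𝟙 (eq zero)) (card-cong (eq ∘ suc))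

∑-mono-≤ : ∀ {n} {f g : Fin n → ℕ} → (∀ i → f i ≤ g i) → sum f ≤ sum g
∑-mono-≤ {zero}  le = z≤n
∑-mono-≤ {suc n} le = ℕ.+-mono-≤ (le zero) (∑-mono-≤ (le ∘ suc))

remove : ∀ {n} → (Fin n → Bool) → Fin n → Fin n → Bool
remove Q y x = Q x ∧ not (does (x ≟ y))

card-remove : ∀ {n} (Q : Fin n → Bool) {y} → Q y ≡ true → card Q ≡ suc (card (remove Q y))
card-remove {suc n} Q {zero} Q0 = begin
  𝟙 (Q zero) + card (Q ∘ suc)          ≡⟨ cong (λ b → 𝟙 b + card (Q ∘ suc)) Q0 ⟩
  suc (card (Q ∘ suc))                 ≡⟨ cong suc (card-cong (sym ∘ ∧-identityʳ ∘ Q ∘ suc)) ⟩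
  suc (card (remove Q zero ∘ suc))     ≡⟨ cong (λ b → suc (𝟙 b + rest)) (∧-zeroʳ (Q zero)) ⟨
  suc (card (remove Q zero))           ∎
  where
  open ≡-Reasoning
  rest = card (remove Q zero ∘ suc)
card-remove {suc n} Q {suc y} Qy = begin
  𝟙 (Q zero) + card (Q ∘ suc)          ≡⟨ cong (𝟙 (Q zero) +_) (card-remove (Q ∘ suc) Qy) ⟩
  𝟙 (Q zero) + suc rest                ≡⟨ ℕ.+-suc (𝟙 (Q zero)) rest ⟩
  suc (𝟙 (Q zero) + rest)              ≡⟨ cong (λ b → suc (𝟙 b + rest)) (∧-identityʳ (Q zero)) ⟨
  suc (card (remove Q (suc y)))        ∎
  where
  open ≡-Reasoning
  rest = card (remove (Q ∘ suc) y)

card-inj : ∀ {m n} (P : Fin m → Bool) (Q : Fin n → Bool) (f : ∀ x → P x ≡ true → Fin n) →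
           (∀ x p → Q (f x p) ≡ true) → (∀ x x′ p p′ → f x p ≡ f x′ p′ → x ≡ x′) →
           card P ≤ card Q
card-inj {zero}  P Q f f∈Q f-inj = z≤n
card-inj {suc m} P Q f f∈Q f-inj with P zero in P0
... | false = card-inj (P ∘ suc) Q (f ∘ suc) (f∈Q ∘ suc)
                (λ x x′ p p′ → suc-injective ∘ f-inj (suc x) (suc x′) p p′)
... | true = subst (suc (card (P ∘ suc)) ≤_) (sym (card-remove Q (f∈Q zero P0)))
               (s≤s (card-inj (P ∘ suc) (remove Q y) (f ∘ suc) f∘suc∈Q-y
                 (λ x x′ p p′ → suc-injective ∘ f-inj (suc x) (suc x′) p p′)))
  where
  y = f zero P0
  f∘suc∈Q-y : ∀ x p → remove Q y (f (suc x) p) ≡ true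
  f∘suc∈Q-y x p with f (suc x) p ≟ y in eq
  ... | yes fx≡y = contradiction (f-inj (suc x) zero p P0 fx≡y) λ ()
  ... | no _ = trans (∧-identityʳ _) (f∈Q (suc x) p)

card-mono : ∀ {n} (P Q : Fin n → Bool) → (∀ x → P x ≡ true → Q x ≡ true) → card P ≤ card Q
card-mono P Q P⊆Q = card-inj P Q (λ x _ → x) P⊆Q (λ _ _ _ _ → id)

card≤size : ∀ {n} (P : Fin n → Bool) → card P ≤ n
card≤size {n} P = ℕ.≤-trans (card-mono P (λ _ → true) (λ _ _ → refl)) (ℕ.≤-reflexive (all n))
  where
  all : ∀ n → card {n} (λ _ → true) ≡ n
  all zero = refl
  all (suc n) = cong suc (all n)

atLeast : ∀ {n} → (Fin n → ℕ) → ℕ → Fin n → Bool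
atLeast deg k x = k ≤ᵇ deg x

exactly : ∀ {n} → (Fin n → ℕ) → ℕ → Fin n → Bool
exactly deg k x = deg x ≡ᵇ k

∑-𝟙-suc≤ᵇ≡⊓ : ∀ M d → ∑[ j < M ] 𝟙 (suc (toℕ j) ≤ᵇ d) ≡ M ⊓ d
∑-𝟙-suc≤ᵇ≡⊓ zero    d       = refl
∑-𝟙-suc≤ᵇ≡⊓ (suc M) zero    = sum-replicate-zero M
∑-𝟙-suc≤ᵇ≡⊓ (suc M) (suc d) = cong suc (∑-𝟙-suc≤ᵇ≡⊓ M d)

∑-card-atLeast : ∀ {n} (deg : Fin n → ℕ) M → (∀ x → deg x ≤ M) →
                 ∑[ j < M ] card (atLeast deg (suc (toℕ j))) ≡ sum deg
∑-card-atLeast {n} deg M deg≤M = begin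
  ∑[ j < M ] card (atLeast deg (suc (toℕ j)))
    ≡⟨ sum-cong-≗ {M} (λ j → card≡∑ (atLeast deg (suc (toℕ j)))) ⟩
  ∑[ j < M ] ∑[ x < n ] 𝟙 (suc (toℕ j) ≤ᵇ deg x)
    ≡⟨ ∑-comm {M} {n} (λ j x → 𝟙 (suc (toℕ j) ≤ᵇ deg x)) ⟩
  ∑[ x < n ] ∑[ j < M ] 𝟙 (suc (toℕ j) ≤ᵇ deg x)
    ≡⟨ sum-cong-≗ {n} (λ x → ∑-𝟙-suc≤ᵇ≡⊓ M (deg x)) ⟩
  ∑[ x < n ] (M ⊓ deg x)
    ≡⟨ sum-cong-≗ {n} (λ x → ℕ.m≥n⇒m⊓n≡n (deg≤M x)) ⟩
  sum deg
    ∎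
  where open ≡-Reasoning

𝟙-exactly-atLeast : ∀ d i → 𝟙 (d ≡ᵇ i) + 𝟙 (suc i ≤ᵇ d) ≡ 𝟙 (i ≤ᵇ d)
𝟙-exactly-atLeast zero    zero    = refl
𝟙-exactly-atLeast zero    (suc i) = refl
𝟙-exactly-atLeast (suc d) zero    = refl
𝟙-exactly-atLeast (suc d) (suc zero)    = 𝟙-exactly-atLeast d zero
𝟙-exactly-atLeast (suc d) (suc (suc i)) = 𝟙-exactly-atLeast d (suc i)

card-exactly-atLeast : ∀ {n} (deg : Fin n → ℕ) i →
  card (exactly deg i) + card (atLeast deg (suc i)) ≡ card (atLeast deg i)
card-exactly-atLeast {n} deg i = begin
  card (exactly deg i) + card (atLeast deg (suc i))
    ≡⟨ cong₂ _+_ (card≡∑ (exactly deg i)) (card≡∑ (atLeast deg (suc i))) ⟩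
  sum (𝟙 ∘ exactly deg i) + sum (𝟙 ∘ atLeast deg (suc i))
    ≡⟨ ∑-distrib-+ (𝟙 ∘ exactly deg i) (𝟙 ∘ atLeast deg (suc i)) ⟨
  ∑[ x < n ] (𝟙 (exactly deg i x) + 𝟙 (atLeast deg (suc i) x))
    ≡⟨ sum-cong-≗ {n} (λ x → 𝟙-exactly-atLeast (deg x) i) ⟩
  sum (𝟙 ∘ atLeast deg i)
    ≡⟨ card≡∑ (atLeast deg i) ⟨
  card (atLeast deg i)
    ∎
  where open ≡-Reasoning

card-exactly≤∑ : ∀ {n} (deg : Fin n → ℕ) {i} → 1 ≤ i → card (exactly deg i) ≤ sum deg
card-exactly≤∑ deg {i} 1≤i =
  ℕ.≤-trans (ℕ.≤-reflexive (card≡∑ (exactly deg i))) (∑-mono-≤ (𝟙-exactly≤ ∘ deg))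
  where
  𝟙-exactly≤ : ∀ d → 𝟙 (d ≡ᵇ i) ≤ d
  𝟙-exactly≤ d with d ≡ᵇ i in eq
  ... | false = z≤n
  ... | true = subst (1 ≤_) (sym (ℕ.≡ᵇ⇒≡ d i (subst T (sym eq) _))) 1≤i

handshake : ∀ {m n} (E : Fin m → Fin n → Bool) →
            ∑[ y < n ] card (λ x → E x y) ≡ ∑[ x < m ] card (λ y → E x y)
handshake {m} {n} E = begin
  ∑[ y < n ] card (λ x → E x y)       ≡⟨ sum-cong-≗ {n} (λ y → card≡∑ (λ x → E x y)) ⟩
  ∑[ y < n ] ∑[ x < m ] 𝟙 (E x y)     ≡⟨ ∑-comm {n} {m} (λ y x → 𝟙 (E x y)) ⟩
  ∑[ x < m ] ∑[ y < n ] 𝟙 (E x y)     ≡⟨ sum-cong-≗ {m} (λ x → card≡∑ (E x)) ⟨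
  ∑[ x < m ] card (λ y → E x y)       ∎
  where open ≡-Reasoning

+-≤-≡⇒≡ : ∀ {a b c d} → a ≤ c → b ≤ d → a + b ≡ c + d → a ≡ c × b ≡ d
+-≤-≡⇒≡ {a} {b} {c} {d} a≤c b≤d eq = a≡c , ℕ.+-cancelˡ-≡ c b d (subst (λ z → z + b ≡ c + d) a≡c eq)
  where
  a≡c : a ≡ c
  a≡c = ℕ.≤-antisym a≤c
    (ℕ.+-cancelʳ-≤ d c a (ℕ.≤-trans (ℕ.≤-reflexive (sym eq)) (ℕ.+-monoʳ-≤ a b≤d)))

∑-≡⇒pointwise-≡ : ∀ {n} {f g : Fin n → ℕ} → (∀ i → f i ≤ g i) → sum f ≡ sum g → ∀ i → f i ≡ g i
∑-≡⇒pointwise-≡ f≤g eq zero    = proj₁ (+-≤-≡⇒≡ (f≤g zero) (∑-mono-≤ (f≤g ∘ suc)) eq)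
∑-≡⇒pointwise-≡ f≤g eq (suc i) =
  ∑-≡⇒pointwise-≡ (f≤g ∘ suc) (proj₂ (+-≤-≡⇒≡ (f≤g zero) (∑-mono-≤ (f≤g ∘ suc)) eq)) i

cross-difference : ∀ A B x y a′ b′ {a b} → x + a′ ≡ a → y + b′ ≡ b →
                   B * a ≡ b * A → B * a′ ≡ b′ * A → B * x ≡ y * A
cross-difference A B x y a′ b′ refl refl Ba≡bA Ba′≡b′A =
  ℕ.+-cancelʳ-≡ (B * a′) (B * x) (y * A) (begin
    B * x + B * a′    ≡⟨ ℕ.*-distribˡ-+ B x a′ ⟨
    B * (x + a′)      ≡⟨ Ba≡bA ⟩
    (y + b′) * A      ≡⟨ ℕ.*-distribʳ-+ A y b′ ⟩
    y * A + b′ * A    ≡⟨ cong (y * A +_) Ba′≡b′A ⟨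
    y * A + B * a′    ∎)
  where open ≡-Reasoning

-- Layered graphs

there : ∀ {n} {P : Fin (suc n) → Set} → Σ (Fin n) (P ∘ suc) → Σ (Fin (suc n)) P
there (v , Pv) = suc v , Pv

im-witness : ∀ H S w → im H S w ≡ true →
             Σ (Fin (Graph2.n₁ H)) λ v → S v ≡ true × Graph2.E₁₂ H v w ≡ true
im-witness H = go (Graph2.E₀₁ H) (Graph2.E₁₂ H)
  where
  go : ∀ {n₀ n₁ n₂} (E₀₁ : Fin n₀ → Fin n₁ → Bool) (E₁₂ : Fin n₁ → Fin n₂ → Bool) S w →
       im (record { n₀ = n₀ ; n₁ = n₁ ; n₂ = n₂ ; E₀₁ = E₀₁ ; E₁₂ = E₁₂ }) S w ≡ true →
       Σ (Fin n₁) λ v → S v ≡ true × E₁₂ v w ≡ true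
  go {n₁ = zero}  E₀₁ E₁₂ S w ()
  go {n₁ = suc _} E₀₁ E₁₂ S w w∈im with S zero in S0 | E₁₂ zero w in E0w
  ... | true  | true  = zero , S0 , E0w
  ... | true  | false = there (go (λ u → E₀₁ u ∘ suc) (E₁₂ ∘ suc) (S ∘ suc) w w∈im)
  ... | false | _     = there (go (λ u → E₀₁ u ∘ suc) (E₁₂ ∘ suc) (S ∘ suc) w w∈im)

im⁻¹-witness : ∀ H S u → im⁻¹ H S u ≡ true →
               Σ (Fin (Graph2.n₁ H)) λ v → S v ≡ true × Graph2.E₀₁ H u v ≡ true
im⁻¹-witness H = go (Graph2.E₀₁ H) (Graph2.E₁₂ H)
  where
  go : ∀ {n₀ n₁ n₂} (E₀₁ : Fin n₀ → Fin n₁ → Bool) (E₁₂ : Fin n₁ → Fin n₂ → Bool) S u →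
       im⁻¹ (record { n₀ = n₀ ; n₁ = n₁ ; n₂ = n₂ ; E₀₁ = E₀₁ ; E₁₂ = E₁₂ }) S u ≡ true →
       Σ (Fin n₁) λ v → S v ≡ true × E₀₁ u v ≡ true
  go {n₁ = zero}  E₀₁ E₁₂ S u ()
  go {n₁ = suc _} E₀₁ E₁₂ S u u∈im with S zero in S0 | E₀₁ u zero in Eu0
  ... | true  | true  = zero , S0 , Eu0
  ... | true  | false = there (go (λ u → E₀₁ u ∘ suc) (E₁₂ ∘ suc) (S ∘ suc) u u∈im)
  ... | false | _     = there (go (λ u → E₀₁ u ∘ suc) (E₁₂ ∘ suc) (S ∘ suc) u u∈im)

≤ᵇ-monoʳ : ∀ k {m n} → m ≤ n → (k ≤ᵇ m) ≡ true → (k ≤ᵇ n) ≡ true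
≤ᵇ-monoʳ k {m} {n} m≤n k≤ᵇm =
  Equivalence.to T-≡ (ℕ.≤⇒≤ᵇ (ℕ.≤-trans (ℕ.≤ᵇ⇒≤ k m (Equivalence.from T-≡ k≤ᵇm)) m≤n))

partial-∑-≡⇒≡ : ∀ {f g : ℕ → ℕ} N → (∀ k → f k ≤ g k) →
            (∀ M → N ≤ M → ∑[ j < M ] f (toℕ j) ≡ ∑[ j < M ] g (toℕ j)) → ∀ k → f k ≡ g k
partial-∑-≡⇒≡ {f} {g} N f≤g ∑f≡∑g k =
  subst (λ i → f i ≡ g i) (toℕ-fromℕ< k<M)
    (∑-≡⇒pointwise-≡ (f≤g ∘ toℕ) (∑f≡∑g (suc k + N) (ℕ.m≤n+m N (suc k))) (fromℕ< k<M))
  where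
  k<M : k ℕ.< suc k + N
  k<M = s≤s (ℕ.m≤m+n k N)

module _ (H : Graph2) where
  open Graph2 H

  indeg₁≤indeg₂ : Downward H → ∀ {v w} → E₁₂ v w ≡ true → indeg₁ H v ≤ indeg₂ H w
  indeg₁≤indeg₂ down {v} {w} vw with ψ , ψ-edges , ψ-inj ← down v w vw =
    card-inj (λ u → E₀₁ u v) (λ v′ → E₁₂ v′ w) ψ (λ u p → proj₂ (ψ-edges u p)) ψ-inj

  outdeg₁≤outdeg₀ : Upward H → ∀ {u v} → E₀₁ u v ≡ true → outdeg₁ H v ≤ outdeg₀ H u
  outdeg₁≤outdeg₀ up {u} {v} uv with φ , φ-edges , φ-inj ← up u v uv =
    card-inj (λ w → E₁₂ v w) (λ v′ → E₀₁ u v′) φ (λ w p → proj₁ (φ-edges w p)) φ-inj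

  im-atLeast-indeg : Downward H → ∀ k w →
                     im H (atLeast (indeg₁ H) k) w ≡ true → atLeast (indeg₂ H) k w ≡ true
  im-atLeast-indeg down k w w∈im
    with v , v∈S , vw ← im-witness H (atLeast (indeg₁ H) k) w w∈im =
    ≤ᵇ-monoʳ k (indeg₁≤indeg₂ down vw) v∈S

  im⁻¹-atLeast-outdeg : Upward H → ∀ k u →
                        im⁻¹ H (atLeast (outdeg₁ H) k) u ≡ true → atLeast (outdeg₀ H) k u ≡ true
  im⁻¹-atLeast-outdeg up k u u∈im
    with v , v∈S , uv ← im⁻¹-witness H (atLeast (outdeg₁ H) k) u u∈im =
    ≤ᵇ-monoʳ k (outdeg₁≤outdeg₀ up uv) v∈S

module DegreeCounts (C : ℝ⁺) (H : Graph2) (commutative : Commutative H)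
  (expanding : ∀ (S : Fin (Graph2.n₁ H) → Bool) →
    (C · card S ≤ℕ card (im H S)) × (C ⁻¹· card S ≤ℕ card (im⁻¹ H S))) where
  open Graph2 H

  a b c d : ℕ → ℕ
  a = card ∘ atLeast (indeg₁ H)
  b = card ∘ atLeast (indeg₂ H)
  c = card ∘ atLeast (outdeg₁ H)
  d = card ∘ atLeast (outdeg₀ H)

  e₀₁ e₁₂ : ℕ
  e₀₁ = sum (indeg₁ H)
  e₁₂ = sum (indeg₂ H)

  C·a≤b : ∀ k → C · a k ≤ℕ b k
  C·a≤b k = ·≤ℕ-monoʳ C {a k} {card (im H S)} (proj₁ (expanding S))
    (card-mono (im H S) (atLeast (indeg₂ H) k) (im-atLeast-indeg H (proj₂ commutative) k))
    where S = atLeast (indeg₁ H) k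

  c≤C·d : ∀ k → c k ≤ℕ C · d k
  c≤C·d k = ≤ℕ·-monoʳ C {c k} {card (im⁻¹ H S)} (proj₂ (expanding S))
    (card-mono (im⁻¹ H S) (atLeast (outdeg₀ H) k) (im⁻¹-atLeast-outdeg H (proj₁ commutative) k))
    where S = atLeast (outdeg₁ H) k

  N : ℕ
  N = n₀ + n₁ + n₂

  ∑-atLeast-beyond : ∀ {n} (deg : Fin n → ℕ) {s} → (∀ x → deg x ≤ s) → s ≤ N →
                     ∀ M → N ≤ M → ∑[ j < M ] card (atLeast deg (suc (toℕ j))) ≡ sum deg
  ∑-atLeast-beyond deg deg≤s s≤N M N≤M =
    ∑-card-atLeast deg M (λ x → ℕ.≤-trans (deg≤s x) (ℕ.≤-trans s≤N N≤M))

  n₀≤N : n₀ ≤ N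
  n₀≤N = ℕ.≤-trans (ℕ.m≤m+n n₀ n₁) (ℕ.m≤m+n (n₀ + n₁) n₂)

  n₁≤N : n₁ ≤ N
  n₁≤N = ℕ.≤-trans (ℕ.m≤n+m n₁ n₀) (ℕ.m≤m+n (n₀ + n₁) n₂)

  n₂≤N : n₂ ≤ N
  n₂≤N = ℕ.m≤n+m n₂ (n₀ + n₁)

  ∑a : ∀ M → N ≤ M → ∑[ j < M ] a (suc (toℕ j)) ≡ e₀₁
  ∑a = ∑-atLeast-beyond (indeg₁ H) (λ _ → card≤size _) n₀≤N

  ∑b : ∀ M → N ≤ M → ∑[ j < M ] b (suc (toℕ j)) ≡ e₁₂
  ∑b = ∑-atLeast-beyond (indeg₂ H) (λ _ → card≤size _) n₁≤N

  ∑c : ∀ M → N ≤ M → ∑[ j < M ] c (suc (toℕ j)) ≡ e₁₂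
  ∑c M N≤M = trans (∑-atLeast-beyond (outdeg₁ H) (λ _ → card≤size _) n₂≤N M N≤M)
                   (sym (handshake E₁₂))

  ∑d : ∀ M → N ≤ M → ∑[ j < M ] d (suc (toℕ j)) ≡ e₀₁
  ∑d M N≤M = trans (∑-atLeast-beyond (outdeg₀ H) (λ _ → card≤size _) n₁≤N M N≤M)
                   (sym (handshake E₀₁))

  C·e₀₁≤e₁₂ : C · e₀₁ ≤ℕ e₁₂
  C·e₀₁≤e₁₂ = subst₂ (C ·_≤ℕ_) (∑a N ℕ.≤-refl) (∑b N ℕ.≤-refl)
    (·≤ℕ-∑ C {N} {a ∘ suc ∘ toℕ} {b ∘ suc ∘ toℕ} (C·a≤b ∘ suc ∘ toℕ))

  e₁₂≤C·e₀₁ : e₁₂ ≤ℕ C · e₀₁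
  e₁₂≤C·e₀₁ = subst₂ (_≤ℕ C ·_) (∑c N ℕ.≤-refl) (∑d N ℕ.≤-refl)
    (≤ℕ·-∑ C {N} {d ∘ suc ∘ toℕ} {c ∘ suc ∘ toℕ} (c≤C·d ∘ suc ∘ toℕ))

  Conclusion : ℕ → Set
  Conclusion i = (C · card (X H i) ≡ℕ card (Y H i)) × (C ⁻¹· card (X′ H i) ≡ℕ card (Y′ H i))

  without-edges : e₀₁ ≡ 0 → ∀ i → 1 ≤ i → Conclusion i
  without-edges e₀₁≡0 i 1≤i = both-empty (indeg₁ H) (indeg₂ H) e₀₁≡0 e₁₂≡0 ,
                               both-empty (outdeg₀ H) (outdeg₁ H) ∑outdeg₀≡0 ∑outdeg₁≡0
    where
    e₁₂≡0 : e₁₂ ≡ 0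
    e₁₂≡0 = ≤ℕ·-zero C (subst (λ e → e₁₂ ≤ℕ C · e) e₀₁≡0 e₁₂≤C·e₀₁)
    ∑outdeg₀≡0 : sum (outdeg₀ H) ≡ 0
    ∑outdeg₀≡0 = trans (sym (handshake E₀₁)) e₀₁≡0
    ∑outdeg₁≡0 : sum (outdeg₁ H) ≡ 0
    ∑outdeg₁≡0 = trans (sym (handshake E₁₂)) e₁₂≡0
    empty : ∀ {n} (deg : Fin n → ℕ) → sum deg ≡ 0 → card (exactly deg i) ≡ 0
    empty deg ∑≡0 = ℕ.n≤0⇒n≡0 (subst (card (exactly deg i) ≤_) ∑≡0 (card-exactly≤∑ deg 1≤i))
    both-empty : ∀ {m n} (deg : Fin m → ℕ) (deg′ : Fin n → ℕ) → sum deg ≡ 0 → sum deg′ ≡ 0 →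
                 C · card (exactly deg i) ≡ℕ card (exactly deg′ i)
    both-empty deg deg′ ∑≡0 ∑′≡0 rewrite empty deg ∑≡0 | empty deg′ ∑′≡0 = ·≡ℕ-zero C

  module _ .{{_ : ℕ.NonZero e₀₁}} where

    C·e₀₁≡e₁₂ : C · e₀₁ ≡ℕ e₁₂
    C·e₀₁≡e₁₂ = C·e₀₁≤e₁₂ , e₁₂≤C·e₀₁

    e₁₂a≡be₀₁ : ∀ k → e₁₂ * a (suc k) ≡ b (suc k) * e₀₁
    e₁₂a≡be₀₁ = partial-∑-≡⇒≡ N
      (λ k → ·≤ℕ⇒cross C e₀₁ e₁₂ C·e₀₁≡e₁₂ (a (suc k)) (b (suc k)) (C·a≤b (suc k)))
      λ M N≤M → begin
      ∑[ j < M ] (e₁₂ * a (suc (toℕ j)))  ≡⟨ *-distribˡ-sum {M} e₁₂ (a ∘ suc ∘ toℕ) ⟨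
      e₁₂ * ∑[ j < M ] a (suc (toℕ j))    ≡⟨ cong (e₁₂ *_) (∑a M N≤M) ⟩
      e₁₂ * e₀₁                           ≡⟨ cong (_* e₀₁) (∑b M N≤M) ⟨
      (∑[ j < M ] b (suc (toℕ j))) * e₀₁  ≡⟨ *-distribʳ-sum {M} e₀₁ (b ∘ suc ∘ toℕ) ⟩
      ∑[ j < M ] (b (suc (toℕ j)) * e₀₁)  ∎
      where open ≡-Reasoning

    e₁₂d≡ce₀₁ : ∀ k → e₁₂ * d (suc k) ≡ c (suc k) * e₀₁
    e₁₂d≡ce₀₁ k = sym (partial-∑-≡⇒≡ N
      (λ j → ≤ℕ·⇒cross C e₀₁ e₁₂ C·e₀₁≡e₁₂ (c (suc j)) (d (suc j)) (c≤C·d (suc j)))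
      (λ M N≤M → begin
      ∑[ j < M ] (c (suc (toℕ j)) * e₀₁)  ≡⟨ *-distribʳ-sum {M} e₀₁ (c ∘ suc ∘ toℕ) ⟨
      (∑[ j < M ] c (suc (toℕ j))) * e₀₁  ≡⟨ cong (_* e₀₁) (∑c M N≤M) ⟩
      e₁₂ * e₀₁                           ≡⟨ cong (e₁₂ *_) (∑d M N≤M) ⟨
      e₁₂ * ∑[ j < M ] d (suc (toℕ j))    ≡⟨ *-distribˡ-sum {M} e₁₂ (d ∘ suc ∘ toℕ) ⟩
      ∑[ j < M ] (e₁₂ * d (suc (toℕ j)))  ∎) k)
      where open ≡-Reasoning

    exactly-ratio : ∀ {m n} (deg : Fin m → ℕ) (deg′ : Fin n → ℕ) →
      (∀ k → e₁₂ * card (atLeast deg (suc k)) ≡ card (atLeast deg′ (suc k)) * e₀₁) →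
      ∀ i → 1 ≤ i → C · card (exactly deg i) ≡ℕ card (exactly deg′ i)
    exactly-ratio deg deg′ atLeast-ratio (suc i) _ = cross⇒·≡ℕ C e₀₁ e₁₂ C·e₀₁≡e₁₂ x y
      (cross-difference e₀₁ e₁₂ x y (card (atLeast deg (2 + i))) (card (atLeast deg′ (2 + i)))
        (card-exactly-atLeast deg (suc i)) (card-exactly-atLeast deg′ (suc i))
        (atLeast-ratio i) (atLeast-ratio (suc i)))
      where
      x = card (exactly deg (suc i))
      y = card (exactly deg′ (suc i))

    with-edges : ∀ i → 1 ≤ i → Conclusion i
    with-edges i 1≤i = exactly-ratio (indeg₁ H) (indeg₂ H) e₁₂a≡be₀₁ i 1≤i ,
                       exactly-ratio (outdeg₀ H) (outdeg₁ H) e₁₂d≡ce₀₁ i 1≤i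

  degree-class-ratios : ∀ i → 1 ≤ i → Conclusion i
  degree-class-ratios with e₀₁ ℕ.≟ 0
  ... | yes no-edges  = without-edges no-edges
  ... | no some-edges = with-edges {{ℕ.≢-nonZero some-edges}}

lemma3 : (C : ℝ⁺) (H : Graph2) → Commutative H →
    (∀ (S : Fin (Graph2.n₁ H) → Bool) →
      (C · card S ≤ℕ card (im H S)) × (C ⁻¹· card S ≤ℕ card (im⁻¹ H S))) →
    ∀ (i : ℕ) → i ≥ 1 →
      (C · card (X H i) ≡ℕ card (Y H i)) × (C ⁻¹· card (X′ H i) ≡ℕ card (Y′ H i))
lemma3 = DegreeCounts.degree-class-ratios
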